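{- Let $S$ be a spider of order $n$ with $k\geq 3$ legs, exactly $y$ of which have length $2$. Then $$\gamma_{tR}(S)=\begin{cases} n & \text{if } y\geq k-1,\\ n-k+y+1 & \text{if } 1\leq y<k-1,\\ n-k+2 & \text{if } y=0.\end{cases}$$
   Context: All graphs are finite and simple. A spider $\mathrm{Sp}(l_1,\dots,l_k)$, $l_i\geq 1$, $k\geq 2$, is the tree obtained from the star $K_{1,k}$ with centre $u$ and leaves $v_1,\dots,v_k$ by subdividing the edge $uv_i$ exactly $l_i-1$ times; the $u$–$v_i$ paths (of length $l_i$) are its legs. For a graph $G$ with no isolated vertices, a total Roman dominating function is a map $f:V(G)\to\{0,1,2\}$ such that every vertex with $f(v)=0$ is adjacent to a vertex $u$ with $f(u)=2$, and the subgraph induced by $\{v:f(v)>0\}$ has no isolated vertices; $\gamma_{tR}(G)$ is the minimum of $\sum_v f(v)$ over such $f$. -}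

module Defs where

open import Data.Nat using (ℕ; zero; suc; _+_; _≤_; _<_; _≟_)
open import Data.Fin using (Fin; toℕ)
open import Data.List using (List; length; map; take; lookup; filter; allFin)
open import Data.Nat.ListAction using (sum)
open import Data.Product using (Σ; _×_; ∃)
open import Data.Sum using (_⊎_)
open import Relation.Binary.PropositionalEquality using (_≡_)

record Graph : Set₁ where
  field
    order : ℕ
    Adj   : Fin order → Fin order → Set

open Graph public

record IsTRDF (G : Graph) (f : Fin (order G) → Fin 3) : Set where
  field
    dom   : ∀ v → toℕ (f v) ≡ 0 → ∃ λ u → Adj G v u × toℕ (f u) ≡ 2
    -- the subgraph induced by positive vertices has no isolated vertices
    total : ∀ v → 0 < toℕ (f v) → ∃ λ u → Adj G v u × 0 < toℕ (f u)

weight : (G : Graph) → (Fin (order G) → Fin 3) → ℕ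
weight G f = sum (map (λ v → toℕ (f v)) (allFin (order G)))

γtR≡ : Graph → ℕ → Set
γtR≡ G m =
  (Σ (Fin (order G) → Fin 3) λ f → IsTRDF G f × weight G f ≡ m)
  × (∀ f → IsTRDF G f → m ≤ weight G f)

-- Spider Sp(l_1,…,l_k), given by the list of leg lengths ls (k = length ls).
-- Vertices are Fin (1 + sum ls): vertex 0 is the centre, leg i occupies
-- vertices P i + 1, …, P i + l_i (in order away from the centre), where
-- P i = l_1 + … + l_{i-1}.
legStart : (ls : List ℕ) → Fin (length ls) → ℕ
legStart ls i = sum (take (toℕ i) ls)

SpArc : (ls : List ℕ) → ℕ → ℕ → Set
SpArc ls a b =
  (a ≡ 0 × ∃ λ (i : Fin (length ls)) → b ≡ legStart ls i + 1)
  ⊎ (∃ λ (i : Fin (length ls)) → ∃ λ j →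
       1 ≤ j × j < lookup ls i × a ≡ legStart ls i + j × b ≡ legStart ls i + j + 1)

spider : List ℕ → Graph
spider ls = record
  { order = suc (sum ls)
  ; Adj   = λ u v → SpArc ls (toℕ u) (toℕ v) ⊎ SpArc ls (toℕ v) (toℕ u)
  }

legs2 : List ℕ → ℕ
legs2 ls = length (filter (_≟ 2) ls)

-- A TRDF of a spider restricts to each leg as a labelling of a path hanging off the centre. Along
-- such a path the labels add up to at least its length, except that a centre labelled 2 may
-- dominate a first leg vertex labelled 0 (saving 1), while a first leg vertex labelled 2 that
-- dominates a centre labelled 0 costs 1 more. Hence the weight is at least n, unless the centre is
-- labelled 2, when it is at least n + 1 − d for the number d of legs starting with a 0. A leg of
-- length 2 cannot start with a 0, and the centre needs a positive neighbour, so d ≤ k − y and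
-- d ≤ k − 1. These bounds are attained by labelling every vertex 1, or the centre 2 and the legs
-- 0,1,…,1, except that the legs of length 2 (or, if there are none, one chosen leg) get 1,…,1.

module Submission where

open import Defs
open import Data.Nat using (ℕ; _+_; _∸_; _≤_; _<_; _≥_)
open import Data.List using (List; length)
open import Data.List.Relation.Unary.All using (All)
open import Data.Product using (_×_)
open import Relation.Binary.PropositionalEquality using (_≡_)

open import Data.Empty using (⊥-elim)
open import Data.Fin using (Fin; zero; suc; toℕ; fromℕ<; punchIn)
open import Data.Fin.Properties using (toℕ<n; toℕ-fromℕ<; toℕ-injective)
open import Data.List using ([]; _∷_; lookup; tabulate; map; allFin)
open import Data.List.Membership.Propositional.Properties using (∈-lookup)
open import Data.List.Properties using (map-tabulate)
open import Data.List.Relation.Unary.All using ([]; _∷_)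
import Data.List.Relation.Unary.All as All
open import Data.Nat using (zero; suc; z≤n; s≤s; z<s; s<s; s≤s⁻¹; s<s⁻¹; _<?_)
open import Data.Nat.ListAction using (sum)
open import Data.Nat.Properties
open import Algebra.Properties.CommutativeMonoid.Sum +-0-commutativeMonoid
  using (sum-syntax; ∑-distrib-+; sum-cong-≗; sum-remove; sum-replicate-zero)
open import Data.Nat.Solver using (module +-*-Solver)
open import Data.Product using (∃; ∃₂; _,_)
open import Data.Sum using (_⊎_; inj₁; inj₂)
open import Function using (_∘_; id)
open import Relation.Binary.Definitions using (tri<; tri≈; tri>)
open import Relation.Binary.PropositionalEquality
  using (_≢_; refl; sym; trans; cong; cong₂; subst; subst₂; module ≡-Reasoning)
open import Relation.Nullary using (yes; no)

open +-*-Solver using (solve; _:=_; _:+_; con)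

-- Sums and arithmetic

m+[1+n]≡m+n+1 : ∀ m n → m + suc n ≡ m + n + 1
m+[1+n]≡m+n+1 m n = trans (+-suc m n) (+-comm 1 (m + n))

+-cross-cancel-≤ : ∀ {u v w z x y} → u + x ≤ v + y → y + w ≤ x + z → u + w ≤ v + z
+-cross-cancel-≤ {u} {v} {w} {z} {x} {y} ux≤vy yw≤xz = +-cancelʳ-≤ (x + y) (u + w) (v + z) (begin
  u + w + (x + y)  ≡⟨ solve 4 (λ u w x y → u :+ w :+ (x :+ y) := u :+ x :+ (y :+ w)) refl u w x y ⟩
  u + x + (y + w)  ≤⟨ +-mono-≤ ux≤vy yw≤xz ⟩
  v + y + (x + z)  ≡⟨ solve 4 (λ v z x y → v :+ y :+ (x :+ z) := v :+ z :+ (x :+ y)) refl v z x y ⟩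
  v + z + (x + y)  ∎)
  where open ≤-Reasoning

n∸k+c+k≡n+c : ∀ {n k} c → k ≤ n → n ∸ k + c + k ≡ n + c
n∸k+c+k≡n+c {n} {k} c k≤n = begin
  n ∸ k + c + k      ≡⟨ +-assoc (n ∸ k) c k ⟩
  n ∸ k + (c + k)    ≡⟨ cong (n ∸ k +_) (+-comm c k) ⟩
  n ∸ k + (k + c)    ≡⟨ +-assoc (n ∸ k) k c ⟨
  n ∸ k + k + c      ≡⟨ cong (_+ c) (m∸n+n≡m k≤n) ⟩
  n + c              ∎
  where open ≡-Reasoning

∸-+-≤ : ∀ {n k c w} → k ≤ n → n + c ≤ w + k → n ∸ k + c ≤ w
∸-+-≤ {n} {k} {c} {w} k≤n n+c≤w+k =
  +-cancelʳ-≤ k (n ∸ k + c) w (subst (_≤ w + k) (sym (n∸k+c+k≡n+c c k≤n)) n+c≤w+k)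

∸-+-≡ : ∀ {n k c w} → k ≤ n → w + k ≡ n + c → w ≡ n ∸ k + c
∸-+-≡ {n} {k} {c} {w} k≤n w+k≡n+c =
  +-cancelʳ-≡ k w (n ∸ k + c) (trans w+k≡n+c (sym (n∸k+c+k≡n+c c k≤n)))

∑< : ℕ → (ℕ → ℕ) → ℕ
∑< zero    g = 0
∑< (suc n) g = g 0 + ∑< n (g ∘ suc)

∑<-cong : ∀ n {g g′ : ℕ → ℕ} → (∀ {j} → j < n → g j ≡ g′ j) → ∑< n g ≡ ∑< n g′
∑<-cong zero    _    = refl
∑<-cong (suc n) g≗g′ = cong₂ _+_ (g≗g′ z<s) (∑<-cong n (g≗g′ ∘ s<s))

∑<-+ : ∀ m n (g : ℕ → ℕ) → ∑< (m + n) g ≡ ∑< m g + ∑< n (λ j → g (m + j))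
∑<-+ zero    n g = refl
∑<-+ (suc m) n g = trans (cong (g 0 +_) (∑<-+ m n (g ∘ suc))) (sym (+-assoc (g 0) _ _))

∑<-const-1 : ∀ n → ∑< n (λ _ → 1) ≡ n
∑<-const-1 zero    = refl
∑<-const-1 (suc n) = cong suc (∑<-const-1 n)

sum-tabulate : ∀ n (q : Fin n → ℕ) {g : ℕ → ℕ} → (∀ i → q i ≡ g (toℕ i)) → sum (tabulate q) ≡ ∑< n g
sum-tabulate zero    q q≗g = refl
sum-tabulate (suc n) q q≗g = cong₂ _+_ (q≗g zero) (sum-tabulate n (q ∘ suc) (q≗g ∘ suc))

∑-mono-≤ : ∀ {k} {f g : Fin k → ℕ} → (∀ i → f i ≤ g i) → ∑[ i < k ] f i ≤ ∑[ i < k ] g i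
∑-mono-≤ {zero}  _   = z≤n
∑-mono-≤ {suc k} f≤g = +-mono-≤ (f≤g zero) (∑-mono-≤ (f≤g ∘ suc))

∑-const-1 : ∀ k → ∑[ i < k ] 1 ≡ k
∑-const-1 zero    = refl
∑-const-1 (suc k) = cong suc (∑-const-1 k)

≤-∑ : ∀ {k} (f : Fin k → ℕ) i → f i ≤ ∑[ j < k ] f j
≤-∑ {suc k} f i = subst (f i ≤_) (sym (sum-remove {i = i} f)) (m≤m+n (f i) _)

∑-positive : ∀ {k} (f : Fin k → ℕ) → 0 < ∑[ i < k ] f i → ∃ λ i → 0 < f i
∑-positive {suc k} f pos with f zero in f₀≡
... | suc _ = zero , subst (0 <_) (sym f₀≡) z<s
... | zero  with ∑-positive (f ∘ suc) pos
...   | i , 0<fi = suc i , 0<fi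

∑-indicator-< : ∀ {k} (f : Fin k → ℕ) → (∀ i → f i ≤ 1) → ∀ i → f i ≡ 0 → ∑[ j < k ] f j < k
∑-indicator-< {suc k} f f≤1 i fi≡0 = begin-strict
  ∑[ j < suc k ] f j           ≡⟨ sum-remove {i = i} f ⟩
  f i + ∑[ j < k ] f (punchIn i j) ≡⟨ cong (_+ ∑[ j < k ] f (punchIn i j)) fi≡0 ⟩
  ∑[ j < k ] f (punchIn i j)   ≤⟨ ∑-mono-≤ (f≤1 ∘ punchIn i) ⟩
  ∑[ j < k ] 1                 ≡⟨ ∑-const-1 k ⟩
  k                            <⟨ n<1+n k ⟩
  suc k                        ∎
  where open ≤-Reasoning

∑-lookup : ∀ ls → ∑[ i < length ls ] lookup ls i ≡ sum ls
∑-lookup []       = refl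
∑-lookup (l ∷ ls) = cong (l +_) (∑-lookup ls)

All-lookup : ∀ {P : ℕ → Set} {ls} → All P ls → ∀ i → P (lookup ls i)
All-lookup Pls i = All.lookup Pls (∈-lookup i)

-- Legs

χ₂₀ : ℕ → ℕ → ℕ
χ₂₀ 2 0 = 1
χ₂₀ _ _ = 0

χ₂₀-≤1 : ∀ x y → χ₂₀ x y ≤ 1
χ₂₀-≤1 0                   y       = z≤n
χ₂₀-≤1 1                   y       = z≤n
χ₂₀-≤1 2                   zero    = ≤-refl
χ₂₀-≤1 2                   (suc y) = z≤n
χ₂₀-≤1 (suc (suc (suc x))) y       = z≤n

χ₂₀-positive : ∀ x {y} → 0 < y → χ₂₀ x y ≡ 0
χ₂₀-positive 0                   _   = refl
χ₂₀-positive 1                   _   = refl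
χ₂₀-positive 2                   z<s = refl
χ₂₀-positive (suc (suc (suc x))) _   = refl

before : ℕ → (ℕ → ℕ) → ℕ → ℕ
before a g zero    = a
before a g (suc j) = g j

HasNeighbour : (ℕ → Set) → ℕ → (ℕ → ℕ) → ℕ → ℕ → Set
HasNeighbour P a g m j = P (before a g j) ⊎ (suc j < m × P (g (suc j)))

-- The conditions of a total Roman dominating function at the vertices v₀, …, v_{m-1} of a
-- path labelled by g, whose end v₀ is also adjacent to a vertex labelled a.
record LegTRDF (a : ℕ) (g : ℕ → ℕ) (m : ℕ) : Set where
  field
    bounded : ∀ j → j < m → g j ≤ 2
    dom     : ∀ j → j < m → g j ≡ 0 → HasNeighbour (_≡ 2) a g m j
    total   : ∀ j → j < m → 0 < g j → HasNeighbour (0 <_) a g m j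

HasNeighbour-tail : ∀ {P a g m} j → HasNeighbour P a g (suc m) (suc j) → HasNeighbour P (g 0) (g ∘ suc) m j
HasNeighbour-tail zero    (inj₁ p)           = inj₁ p
HasNeighbour-tail (suc j) (inj₁ p)           = inj₁ p
HasNeighbour-tail j       (inj₂ (j+2≤m , p)) = inj₂ (s<s⁻¹ j+2≤m , p)

LegTRDF-tail : ∀ {a g m} → LegTRDF a g (suc m) → LegTRDF (g 0) (g ∘ suc) m
LegTRDF-tail {a} {g} L = record
  { bounded = λ j j<m → bounded (suc j) (s<s j<m)
  ; dom     = λ j j<m gj≡0 → HasNeighbour-tail {_≡ 2} {a} {g} j (dom (suc j) (s<s j<m) gj≡0)
  ; total   = λ j j<m 0<gj → HasNeighbour-tail {0 <_} {a} {g} j (total (suc j) (s<s j<m) 0<gj)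
  }
  where open LegTRDF L

HasNeighbour-cong : ∀ {P a g g′ m} j → (∀ {i} → i < m → g′ i ≡ g i) → j < m →
                    HasNeighbour P a g m j → HasNeighbour P a g′ m j
HasNeighbour-cong     zero    _    _   (inj₁ p)           = inj₁ p
HasNeighbour-cong {P} (suc j) g′≗g j<m (inj₁ p)           = inj₁ (subst P (sym (g′≗g (<-trans (n<1+n j) j<m))) p)
HasNeighbour-cong {P} j       g′≗g _   (inj₂ (j+1<m , p)) = inj₂ (j+1<m , subst P (sym (g′≗g j+1<m)) p)

LegTRDF-cong : ∀ {a g g′ m} → (∀ {j} → j < m → g′ j ≡ g j) → LegTRDF a g m → LegTRDF a g′ m
LegTRDF-cong g′≗g L = record
  { bounded = λ j j<m → subst (_≤ 2) (sym (g′≗g j<m)) (bounded j j<m)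
  ; dom     = λ j j<m g′j≡0 → HasNeighbour-cong {_≡ 2} j g′≗g j<m (dom j j<m (trans (sym (g′≗g j<m)) g′j≡0))
  ; total   = λ j j<m 0<g′j → HasNeighbour-cong {0 <_} j g′≗g j<m (total j j<m (subst (0 <_) (g′≗g j<m) 0<g′j))
  }
  where open LegTRDF L

-- Summed along a leg, the terms between consecutive leg vertices cancel, giving leg-bound.
vertex-balance : ∀ a b c → b ≤ 2 → (b ≡ 0 → a ≡ 2 ⊎ c ≡ 2) → (0 < b → 0 < a ⊎ 0 < c) →
                 χ₂₀ b a + 1 + χ₂₀ b c ≤ χ₂₀ a b + b + χ₂₀ c b
vertex-balance a 0 c _ dom _ with dom refl
... | inj₁ refl = s≤s z≤n
... | inj₂ refl = m≤n+m 1 _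
vertex-balance a 1 c _ _ _ = ≤-trans (m≤n+m 1 (χ₂₀ a 1)) (m≤m+n _ _)
vertex-balance a 2 c _ _ total with total z<s
... | inj₁ (s≤s {n = a′} _) =
  ≤-trans (s≤s (χ₂₀-≤1 2 c)) (≤-trans (m≤n+m 2 (χ₂₀ (suc a′) 2)) (m≤m+n _ _))
... | inj₂ (s≤s _) =
  ≤-trans (+-monoˡ-≤ 0 (+-monoˡ-≤ 1 (χ₂₀-≤1 2 a))) (≤-trans (m≤n+m 2 (χ₂₀ a 2)) (m≤m+n _ _))
vertex-balance a (suc (suc (suc b))) c (s≤s (s≤s ())) _ _

leg-bound : ∀ {m a g} → 1 ≤ m → LegTRDF a g m → χ₂₀ (g 0) a + m ≤ χ₂₀ a (g 0) + ∑< m g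
leg-bound {1} {a} {g} _ L =
  ≤-trans (m≤m+n _ _)
    (≤-trans (vertex-balance a (g 0) 0 (bounded 0 z<s) (inj₁ ∘ only ∘ dom 0 z<s) (inj₁ ∘ only ∘ total 0 z<s))
             (≤-reflexive (+-assoc _ (g 0) 0)))
  where
  open LegTRDF L
  only : ∀ {P : ℕ → Set} → HasNeighbour P a g 1 0 → P a
  only (inj₁ p)              = p
  only (inj₂ (s≤s () , _))
leg-bound {suc (suc m)} {a} {g} _ L =
  subst₂ _≤_ (+-assoc (χ₂₀ (g 0) a) 1 (suc m)) (+-assoc (χ₂₀ a (g 0)) (g 0) (∑< (suc m) (g ∘ suc)))
    (+-cross-cancel-≤ {x = χ₂₀ (g 0) (g 1)} {y = χ₂₀ (g 1) (g 0)}
      (vertex-balance a (g 0) (g 1) (bounded 0 z<s) (toNext ∘ dom 0 z<s) (toNext ∘ total 0 z<s))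
      (leg-bound z<s (LegTRDF-tail L)))
  where
  open LegTRDF L
  toNext : ∀ {P : ℕ → Set} → HasNeighbour P a g (suc (suc m)) 0 → P a ⊎ P (g 1)
  toNext (inj₁ p)       = inj₁ p
  toNext (inj₂ (_ , p)) = inj₂ p

leg₂-head-positive : ∀ {a g} → LegTRDF a g 2 → 0 < g 0
leg₂-head-positive {g = g} L with g 1 in g₁≡
... | zero with LegTRDF.dom L 1 (s≤s (s≤s z≤n)) g₁≡
...   | inj₁ g₀≡2               = subst (0 <_) (sym g₀≡2) z<s
...   | inj₂ (s≤s (s≤s ()) , _)
leg₂-head-positive {g = g} L | suc _ with LegTRDF.total L 1 (s≤s (s≤s z≤n)) (subst (0 <_) (sym g₁≡) z<s)
...   | inj₁ 0<g₀               = 0<g₀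
...   | inj₂ (s≤s (s≤s ()) , _)

headThenOnes : ℕ → ℕ → ℕ
headThenOnes x zero    = x
headThenOnes x (suc _) = 1

∑<-headThenOnes : ∀ x m → ∑< (suc m) (headThenOnes x) ≡ x + m
∑<-headThenOnes x m = cong (x +_) (∑<-const-1 m)

ones-LegTRDF : ∀ {a} m → 0 < a → LegTRDF a (headThenOnes 1) m
ones-LegTRDF m 0<a = record
  { bounded = λ { zero _ → s≤s z≤n ; (suc _) _ → s≤s z≤n }
  ; dom     = λ { zero _ () ; (suc _) _ () }
  ; total   = λ { zero _ _ → inj₁ 0<a ; 1 _ _ → inj₁ z<s ; (suc (suc _)) _ _ → inj₁ z<s }
  }

zeroThenOnes-LegTRDF : ∀ m → m ≢ 2 → LegTRDF 2 (headThenOnes 0) m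
zeroThenOnes-LegTRDF m m≢2 = record
  { bounded = λ { zero _ → z≤n ; (suc _) _ → s≤s z≤n }
  ; dom     = λ { zero _ _ → inj₁ refl ; (suc _) _ () }
  ; total   = λ { zero _ ()
                ; 1 1<m _ → inj₂ (≤∧≢⇒< 1<m (m≢2 ∘ sym) , z<s)
                ; (suc (suc _)) _ _ → inj₁ z<s }
  }

-- The spider

legVertex : (ls : List ℕ) → Fin (length ls) → ℕ → ℕ
legVertex ls i j = legStart ls i + suc j

SpEdge : List ℕ → ℕ → ℕ → Set
SpEdge ls x y = SpArc ls x y ⊎ SpArc ls y x

legStart+lookup≤sum : ∀ ls i → legStart ls i + lookup ls i ≤ sum ls
legStart+lookup≤sum (l ∷ ls) zero    = m≤m+n l (sum ls)
legStart+lookup≤sum (l ∷ ls) (suc i) =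
  subst (_≤ l + sum ls) (sym (+-assoc l _ _)) (+-monoʳ-≤ l (legStart+lookup≤sum ls i))

legStart+lookup≤legStart : ∀ ls {i i′} → toℕ i < toℕ i′ → legStart ls i + lookup ls i ≤ legStart ls i′
legStart+lookup≤legStart (l ∷ ls) {zero}  {suc i′} _       = m≤m+n l _
legStart+lookup≤legStart (l ∷ ls) {suc i} {suc i′} (s<s i<i′) =
  subst (_≤ l + legStart ls i′) (sym (+-assoc l _ _)) (+-monoʳ-≤ l (legStart+lookup≤legStart ls i<i′))

legVertex<order : ∀ ls i {j} → j < lookup ls i → legVertex ls i j < suc (sum ls)
legVertex<order ls i j<l = s≤s (≤-trans (+-monoʳ-≤ (legStart ls i) j<l) (legStart+lookup≤sum ls i))

legVertex-< : ∀ {ls i i′ j} j′ → toℕ i < toℕ i′ → j < lookup ls i → legVertex ls i j < legVertex ls i′ j′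
legVertex-< {ls} {i} {i′} j′ i<i′ j<l =
  ≤-<-trans (≤-trans (+-monoʳ-≤ (legStart ls i) j<l) (legStart+lookup≤legStart ls i<i′)) (m<m+n _ z<s)

legVertex-injective : ∀ {ls i i′ j j′} → j < lookup ls i → j′ < lookup ls i′ →
                      legVertex ls i j ≡ legVertex ls i′ j′ → i ≡ i′ × j ≡ j′
legVertex-injective {ls} {i} {i′} {j} {j′} j<l j′<l′ eq with <-cmp (toℕ i) (toℕ i′)
... | tri< i<i′ _ _ = ⊥-elim (<⇒≢ (legVertex-< j′ i<i′ j<l) eq)
... | tri> _ _ i′<i = ⊥-elim (<⇒≢ (legVertex-< j i′<i j′<l′) (sym eq))
... | tri≈ _ i≡i′ _ with toℕ-injective i≡i′
...   | refl = refl , suc-injective (+-cancelˡ-≡ (legStart ls i) _ _ eq)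

Fin-legVertex : ∀ ls i {j} → j < lookup ls i → Fin (suc (sum ls))
Fin-legVertex ls i j<l = fromℕ< (legVertex<order ls i j<l)

toℕ-Fin-legVertex : ∀ ls i {j} (j<l : j < lookup ls i) → toℕ (Fin-legVertex ls i j<l) ≡ legVertex ls i j
toℕ-Fin-legVertex ls i j<l = toℕ-fromℕ< (legVertex<order ls i j<l)

legPosition : ∀ ls {m} → m < sum ls → ∃₂ λ i j → j < lookup ls i × m ≡ legStart ls i + j
legPosition (l ∷ ls) {m} m<sum with m <? l
... | yes m<l = zero , m , m<l , refl
... | no  m≮l
  with legPosition ls {m ∸ l} (+-cancelˡ-< l _ _ (subst (_< l + sum ls) (sym (m+[n∸m]≡n (≮⇒≥ m≮l))) m<sum))
...   | i , j , j<l , m∸l≡ = suc i , j , j<l , (begin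
  m                          ≡⟨ m+[n∸m]≡n (≮⇒≥ m≮l) ⟨
  l + (m ∸ l)                ≡⟨ cong (l +_) m∸l≡ ⟩
  l + (legStart ls i + j)    ≡⟨ +-assoc l _ j ⟨
  l + legStart ls i + j      ∎)
  where open ≡-Reasoning

vertex-cases : ∀ ls (v : Fin (suc (sum ls))) →
               toℕ v ≡ 0 ⊎ ∃₂ λ i j → j < lookup ls i × toℕ v ≡ legVertex ls i j
vertex-cases ls zero    = inj₁ refl
vertex-cases ls (suc v) with legPosition ls (toℕ<n v)
... | i , j , j<l , v≡ = inj₂ (i , j , j<l , trans (cong suc v≡) (sym (+-suc _ j)))

centre-adjacent : ∀ ls i → SpEdge ls 0 (legVertex ls i 0)
centre-adjacent ls i = inj₁ (inj₁ (refl , i , refl))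

adjacent-centre : ∀ {ls y} → SpEdge ls 0 y → ∃ λ i → y ≡ legVertex ls i 0
adjacent-centre (inj₁ (inj₁ (_ , i , y≡)))                 = i , y≡
adjacent-centre (inj₁ (inj₂ (_ , zero , () , _)))
adjacent-centre (inj₁ (inj₂ (_ , suc j , _ , _ , 0≡ , _)))  = ⊥-elim (m+1+n≢0 _ (sym 0≡))
adjacent-centre (inj₂ (inj₁ (_ , _ , 0≡)))                  = ⊥-elim (m+1+n≢0 _ (sym 0≡))
adjacent-centre (inj₂ (inj₂ (_ , _ , _ , _ , _ , 0≡)))      = ⊥-elim (m+1+n≢0 _ (sym 0≡))

data LegNeighbour (ls : List ℕ) (i : Fin (length ls)) : ℕ → ℕ → Set where
  centre   : LegNeighbour ls i 0 0
  previous : ∀ j → suc j < lookup ls i → LegNeighbour ls i (suc j) (legVertex ls i j)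
  next     : ∀ j → suc j < lookup ls i → LegNeighbour ls i j (legVertex ls i (suc j))

legNeighbour-adjacent : ∀ {ls i j y} → LegNeighbour ls i j y → SpEdge ls (legVertex ls i j) y
legNeighbour-adjacent {i = i} centre = inj₂ (inj₁ (refl , i , refl))
legNeighbour-adjacent {ls} {i} (previous j j+1<l) =
  inj₂ (inj₂ (i , suc j , s≤s z≤n , j+1<l , refl , m+[1+n]≡m+n+1 (legStart ls i) (suc j)))
legNeighbour-adjacent {ls} {i} (next j j+1<l) =
  inj₁ (inj₂ (i , suc j , s≤s z≤n , j+1<l , refl , m+[1+n]≡m+n+1 (legStart ls i) (suc j)))

adjacent-legNeighbour : ∀ {ls i j x y} → All (1 ≤_) ls → j < lookup ls i → x ≡ legVertex ls i j →
                        SpEdge ls x y → LegNeighbour ls i j y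
adjacent-legNeighbour _ _ refl (inj₁ (inj₁ (x≡0 , _))) = ⊥-elim (m+1+n≢0 _ x≡0)
adjacent-legNeighbour _ _ refl (inj₁ (inj₂ (_ , zero , () , _)))
adjacent-legNeighbour {ls} {i} _ j<l refl (inj₁ (inj₂ (i′ , suc b , _ , b+1<l , x≡ , refl)))
  with legVertex-injective {ls} {i} {i′} j<l (<-trans (n<1+n b) b+1<l) x≡
... | refl , refl = subst (LegNeighbour ls i _) (m+[1+n]≡m+n+1 _ (suc b)) (next b b+1<l)
adjacent-legNeighbour {ls} {i} one j<l refl (inj₂ (inj₁ (refl , i′ , x≡)))
  with legVertex-injective {ls} {i} {i′} j<l (All-lookup one i′) x≡
... | refl , refl = centre
adjacent-legNeighbour _ _ refl (inj₂ (inj₂ (_ , zero , () , _)))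
adjacent-legNeighbour {ls} {i} _ j<l refl (inj₂ (inj₂ (i′ , suc b , _ , b+1<l , refl , x≡)))
  with legVertex-injective {ls} {i} {i′} j<l b+1<l (trans x≡ (sym (m+[1+n]≡m+n+1 _ (suc b))))
... | refl , refl = previous b b+1<l

legNeighbour-< : ∀ {ls i j y} → LegNeighbour ls i j y → y < suc (sum ls)
legNeighbour-<          centre             = z<s
legNeighbour-< {ls} {i} (previous j j+1<l) = legVertex<order ls i (<-trans (n<1+n j) j+1<l)
legNeighbour-< {ls} {i} (next j j+1<l)     = legVertex<order ls i j+1<l

leg : (ℕ → ℕ) → (ls : List ℕ) → Fin (length ls) → ℕ → ℕ
leg h ls i j = h (legVertex ls i j)

legNeighbour-hasNeighbour : ∀ {ls i j y} {P : ℕ → Set} (h : ℕ → ℕ) → LegNeighbour ls i j y → P (h y) →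
                            HasNeighbour P (h 0) (leg h ls i) (lookup ls i) j
legNeighbour-hasNeighbour h centre         p = inj₁ p
legNeighbour-hasNeighbour h (previous _ _) p = inj₁ p
legNeighbour-hasNeighbour h (next _ j+1<l) p = inj₂ (j+1<l , p)

hasNeighbour-legNeighbour : ∀ {ls i} {P : ℕ → Set} (h : ℕ → ℕ) j → j < lookup ls i →
                            HasNeighbour P (h 0) (leg h ls i) (lookup ls i) j → ∃ λ y → LegNeighbour ls i j y × P (h y)
hasNeighbour-legNeighbour         h zero    _   (inj₁ p)           = 0 , centre , p
hasNeighbour-legNeighbour {ls} {i} h (suc j) j<l (inj₁ p)           = legVertex ls i j , previous j j<l , p
hasNeighbour-legNeighbour {ls} {i} h j       _   (inj₂ (j+1<l , p)) = legVertex ls i (suc j) , next j j+1<l , p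

legsWeight : (ls : List ℕ) → (Fin (length ls) → ℕ → ℕ) → ℕ
legsWeight ls p = ∑[ i < length ls ] ∑< (lookup ls i) (p i)

legsWeight-cong : ∀ ls {p q} → (∀ {i j} → j < lookup ls i → p i j ≡ q i j) → legsWeight ls p ≡ legsWeight ls q
legsWeight-cong ls p≗q = sum-cong-≗ (λ i → ∑<-cong (lookup ls i) p≗q)

-- The TRDF conditions for the spider labelled c at the centre and p i j at the j-th vertex of leg i,
-- counting from the centre.
record LegwiseTRDF (ls : List ℕ) (c : ℕ) (p : Fin (length ls) → ℕ → ℕ) : Set where
  field
    centre-≤2    : c ≤ 2
    legs         : ∀ i → LegTRDF c (p i) (lookup ls i)
    centre-dom   : c ≡ 0 → ∃ λ i → p i 0 ≡ 2
    centre-total : 0 < c → ∃ λ i → 0 < p i 0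

LegwiseTRDF-cong : ∀ {ls c p q} → All (1 ≤_) ls → (∀ {i j} → j < lookup ls i → q i j ≡ p i j) →
                   LegwiseTRDF ls c p → LegwiseTRDF ls c q
LegwiseTRDF-cong one q≗p L = record
  { centre-≤2    = centre-≤2
  ; legs         = λ i → LegTRDF-cong q≗p (legs i)
  ; centre-dom   = λ c≡0 → let i , pi0≡2 = centre-dom c≡0 in i , trans (q≗p (All-lookup one i)) pi0≡2
  ; centre-total = λ 0<c → let i , 0<pi0 = centre-total 0<c
                           in i , subst (0 <_) (sym (q≗p (All-lookup one i))) 0<pi0
  }
  where open LegwiseTRDF L

∑<-legs : ∀ ls (h : ℕ → ℕ) → ∑< (sum ls) (h ∘ suc) ≡ legsWeight ls (leg h ls)
∑<-legs []       h = refl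
∑<-legs (l ∷ ls) h = begin
  ∑< (l + sum ls) (h ∘ suc)
    ≡⟨ ∑<-+ l (sum ls) (h ∘ suc) ⟩
  ∑< l (h ∘ suc) + ∑< (sum ls) (λ j → h (suc (l + j)))
    ≡⟨ cong (∑< l (h ∘ suc) +_) (∑<-cong (sum ls) λ {j} _ → cong h (sym (+-suc l j))) ⟩
  ∑< l (h ∘ suc) + ∑< (sum ls) (hₗ ∘ suc)
    ≡⟨ cong (∑< l (h ∘ suc) +_) (∑<-legs ls hₗ) ⟩
  ∑< l (h ∘ suc) + legsWeight ls (leg hₗ ls)
    ≡⟨ cong (∑< l (h ∘ suc) +_) (legsWeight-cong ls λ _ → cong h (sym (+-assoc l _ _))) ⟩
  legsWeight (l ∷ ls) (leg h (l ∷ ls))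
    ∎
  where
  open ≡-Reasoning
  hₗ : ℕ → ℕ
  hₗ m = h (l + m)

weight≡centre+legsWeight : ∀ ls {f : Fin (suc (sum ls)) → Fin 3} {h : ℕ → ℕ} →
                           (∀ v → h (toℕ v) ≡ toℕ (f v)) →
                           weight (spider ls) f ≡ h 0 + legsWeight ls (leg h ls)
weight≡centre+legsWeight ls {f} {h} h≗f = begin
  sum (map (toℕ ∘ f) (allFin _))                     ≡⟨ cong sum (map-tabulate id (toℕ ∘ f)) ⟩
  sum (tabulate (toℕ ∘ f))                           ≡⟨ sum-tabulate _ (toℕ ∘ f) {h} (sym ∘ h≗f) ⟩
  ∑< (suc (sum ls)) h                                ≡⟨ cong (h 0 +_) (∑<-legs ls h) ⟩
  h 0 + legsWeight ls (leg h ls)                     ∎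
  where open ≡-Reasoning

module _ {ls : List ℕ} (one : All (1 ≤_) ls) {f : Fin (suc (sum ls)) → Fin 3} {h : ℕ → ℕ}
         (h≗f : ∀ v → h (toℕ v) ≡ toℕ (f v)) where

  private
    NeighbourWith : (ℕ → Set) → Fin (suc (sum ls)) → Set
    NeighbourWith P v = ∃ λ u → Adj (spider ls) v u × P (toℕ (f u))

    toNeighbour : ∀ {P : ℕ → Set} v y (y<n : y < suc (sum ls)) → SpEdge ls (toℕ v) y → P (h y) → NeighbourWith P v
    toNeighbour {P} v y y<n v~y p =
      fromℕ< y<n ,
      subst (SpEdge ls (toℕ v)) (sym (toℕ-fromℕ< y<n)) v~y ,
      subst P (trans (cong h (sym (toℕ-fromℕ< y<n))) (h≗f _)) p

    fromNeighbour : ∀ {P : ℕ → Set} v → NeighbourWith P v → ∃ λ y → SpEdge ls (toℕ v) y × P (h y)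
    fromNeighbour {P} v (u , v~u , p) = toℕ u , v~u , subst P (sym (h≗f u)) p

    leg≡f : ∀ i {j} (j<l : j < lookup ls i) → leg h ls i j ≡ toℕ (f (Fin-legVertex ls i j<l))
    leg≡f i j<l = trans (cong h (sym (toℕ-Fin-legVertex ls i j<l))) (h≗f _)

  IsTRDF⇒LegwiseTRDF : IsTRDF (spider ls) f → LegwiseTRDF ls (h 0) (leg h ls)
  IsTRDF⇒LegwiseTRDF T = record
    { centre-≤2    = subst (_≤ 2) (sym (h≗f zero)) (s≤s⁻¹ (toℕ<n (f zero)))
    ; legs         = λ i → record
      { bounded = λ j j<l → subst (_≤ 2) (sym (leg≡f i j<l)) (s≤s⁻¹ (toℕ<n (f _)))
      ; dom     = λ j j<l → atLeg {_≡ 0} {_≡ 2} (IsTRDF.dom T) i j<l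
      ; total   = λ j j<l → atLeg {0 <_} {0 <_} (IsTRDF.total T) i j<l
      }
    ; centre-dom   = atCentre {_≡ 0} {_≡ 2} (IsTRDF.dom T)
    ; centre-total = atCentre {0 <_} {0 <_} (IsTRDF.total T)
    }
    where
    atCentre : ∀ {Q P : ℕ → Set} → (∀ v → Q (toℕ (f v)) → NeighbourWith P v) →
               Q (h 0) → ∃ λ i → P (leg h ls i 0)
    atCentre {Q} {P} condition q with fromNeighbour {P} zero (condition zero (subst Q (h≗f zero) q))
    ... | y , 0~y , p with adjacent-centre 0~y
    ...   | i , refl = i , p

    atLeg : ∀ {Q P : ℕ → Set} → (∀ v → Q (toℕ (f v)) → NeighbourWith P v) →
            ∀ i {j} (j<l : j < lookup ls i) → Q (leg h ls i j) → HasNeighbour P (h 0) (leg h ls i) (lookup ls i) j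
    atLeg {Q} {P} condition i j<l q with fromNeighbour {P} _ (condition _ (subst Q (leg≡f i j<l) q))
    ... | y , v~y , p =
      legNeighbour-hasNeighbour {P = P} h (adjacent-legNeighbour one j<l (toℕ-Fin-legVertex ls i j<l) v~y) p

  LegwiseTRDF⇒IsTRDF : LegwiseTRDF ls (h 0) (leg h ls) → IsTRDF (spider ls) f
  LegwiseTRDF⇒IsTRDF L = record
    { dom   = atVertex {_≡ 0} {_≡ 2} centre-dom LegTRDF.dom
    ; total = atVertex {0 <_} {0 <_} centre-total LegTRDF.total
    }
    where
    open LegwiseTRDF L
    atVertex : ∀ {Q P : ℕ → Set} → (Q (h 0) → ∃ λ i → P (leg h ls i 0)) →
               (∀ {a g m} → LegTRDF a g m → ∀ j → j < m → Q (g j) → HasNeighbour P a g m j) →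
               ∀ v → Q (toℕ (f v)) → NeighbourWith P v
    atVertex {Q} {P} atCentre atLeg v q with vertex-cases ls v
    ... | inj₁ v≡0 with atCentre (subst Q (trans (sym (h≗f v)) (cong h v≡0)) q)
    ...   | i , p = toNeighbour {P} v _ (legVertex<order ls i (All-lookup one i))
                      (subst (λ x → SpEdge ls x _) (sym v≡0) (centre-adjacent ls i)) p
    atVertex {Q} {P} atCentre atLeg v q | inj₂ (i , j , j<l , v≡)
      with hasNeighbour-legNeighbour {P = P} h j j<l
             (atLeg (legs i) j j<l (subst Q (trans (sym (h≗f v)) (cong h v≡)) q))
    ... | y , nb , p = toNeighbour {P} v y (legNeighbour-< nb)
                         (subst (λ x → SpEdge ls x y) (sym v≡) (legNeighbour-adjacent nb)) p

concatLegs : (ls : List ℕ) → (Fin (length ls) → ℕ → ℕ) → ℕ → ℕ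
concatLegs []       p m = 0
concatLegs (l ∷ ls) p m with m <? l
... | yes _ = p zero m
... | no  _ = concatLegs ls (p ∘ suc) (m ∸ l)

concatLegs-legStart : ∀ ls p {i j} → j < lookup ls i → concatLegs ls p (legStart ls i + j) ≡ p i j
concatLegs-legStart (l ∷ ls) p {zero} {j} j<l with j <? l
... | yes _   = refl
... | no  j≮l = ⊥-elim (j≮l j<l)
concatLegs-legStart (l ∷ ls) p {suc i} {j} j<l with l + legStart ls i + j <? l
... | yes m<l = ⊥-elim (<⇒≱ m<l (≤-trans (m≤m+n l _) (≤-reflexive (sym (+-assoc l _ j)))))
... | no  _   = trans (cong (concatLegs ls (p ∘ suc)) m∸l≡) (concatLegs-legStart ls (p ∘ suc) j<l)
  where
  m∸l≡ : l + legStart ls i + j ∸ l ≡ legStart ls i + j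
  m∸l≡ = trans (cong (_∸ l) (+-assoc l _ j)) (m+n∸m≡n l _)

concatLegs-≤2 : ∀ ls p → (∀ i {j} → j < lookup ls i → p i j ≤ 2) → ∀ m → concatLegs ls p m ≤ 2
concatLegs-≤2 []       p _   m = z≤n
concatLegs-≤2 (l ∷ ls) p p≤2 m with m <? l
... | yes m<l = p≤2 zero m<l
... | no  _   = concatLegs-≤2 ls (p ∘ suc) (p≤2 ∘ suc) (m ∸ l)

assemble : (ls : List ℕ) → ℕ → (Fin (length ls) → ℕ → ℕ) → ℕ → ℕ
assemble ls c p zero    = c
assemble ls c p (suc m) = concatLegs ls p m

leg-assemble : ∀ ls c p {i j} → j < lookup ls i → leg (assemble ls c p) ls i j ≡ p i j
leg-assemble ls c p {i} {j} j<l =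
  trans (cong (assemble ls c p) (+-suc (legStart ls i) j)) (concatLegs-legStart ls p j<l)

assemble-≤2 : ∀ {ls c p} → LegwiseTRDF ls c p → ∀ m → assemble ls c p m ≤ 2
assemble-≤2 L zero    = LegwiseTRDF.centre-≤2 L
assemble-≤2 {ls} {p = p} L (suc m) = concatLegs-≤2 ls p (λ i {j} → LegTRDF.bounded (LegwiseTRDF.legs L i) j) m

extend : ∀ {n} → (Fin n → Fin 3) → ℕ → ℕ
extend {n} f m with m <? n
... | yes m<n = toℕ (f (fromℕ< m<n))
... | no  _   = 0

extend-toℕ : ∀ {n} (f : Fin n → Fin 3) v → extend f (toℕ v) ≡ toℕ (f v)
extend-toℕ {n} f v with toℕ v <? n
... | yes v<n = cong (toℕ ∘ f) (toℕ-injective (toℕ-fromℕ< v<n))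
... | no  v≮n = ⊥-elim (v≮n (toℕ<n v))

γtR≡-legwise : ∀ {ls m} → All (1 ≤_) ls →
               (∃₂ λ c p → LegwiseTRDF ls c p × c + legsWeight ls p ≡ m) →
               (∀ {c p} → LegwiseTRDF ls c p → m ≤ c + legsWeight ls p) →
               γtR≡ (spider ls) m
γtR≡-legwise {ls} {m} one (c , p , L , weight≡m) lower =
  (f , LegwiseTRDF⇒IsTRDF one {h = h} h≗f L′ , weight≡) , minimal
  where
  h : ℕ → ℕ
  h = assemble ls c p
  f : Fin (suc (sum ls)) → Fin 3
  f v = fromℕ< (s≤s (assemble-≤2 L (toℕ v)))
  h≗f : ∀ v → h (toℕ v) ≡ toℕ (f v)
  h≗f v = sym (toℕ-fromℕ< _)
  L′ : LegwiseTRDF ls c (leg h ls)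
  L′ = LegwiseTRDF-cong one (leg-assemble ls c p) L
  weight≡ : weight (spider ls) f ≡ m
  weight≡ = begin
    weight (spider ls) f          ≡⟨ weight≡centre+legsWeight ls {h = h} h≗f ⟩
    c + legsWeight ls (leg h ls)  ≡⟨ cong (c +_) (legsWeight-cong ls (leg-assemble ls c p)) ⟩
    c + legsWeight ls p           ≡⟨ weight≡m ⟩
    m                             ∎
    where open ≡-Reasoning
  minimal : ∀ g → IsTRDF (spider ls) g → m ≤ weight (spider ls) g
  minimal g T = subst (m ≤_) (sym (weight≡centre+legsWeight ls {h = extend g} (extend-toℕ g)))
                  (lower (IsTRDF⇒LegwiseTRDF one {h = extend g} (extend-toℕ g) T))

-- The lower bound

isTwo : ℕ → ℕ
isTwo 2 = 1
isTwo _ = 0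

isTwo-cases : ∀ l → (l ≡ 2 × isTwo l ≡ 1) ⊎ (l ≢ 2 × isTwo l ≡ 0)
isTwo-cases 0                   = inj₂ ((λ ()) , refl)
isTwo-cases 1                   = inj₂ ((λ ()) , refl)
isTwo-cases 2                   = inj₁ (refl , refl)
isTwo-cases (suc (suc (suc _))) = inj₂ ((λ ()) , refl)

legs2-∑ : ∀ ls → legs2 ls ≡ ∑[ i < length ls ] isTwo (lookup ls i)
legs2-∑ []                       = refl
legs2-∑ (0 ∷ ls)                 = legs2-∑ ls
legs2-∑ (1 ∷ ls)                 = legs2-∑ ls
legs2-∑ (2 ∷ ls)                 = cong suc (legs2-∑ ls)
legs2-∑ (suc (suc (suc _)) ∷ ls) = legs2-∑ ls

∑-+-legs2≤length : ∀ ls (q : Fin (length ls) → ℕ) → (∀ i → q i ≤ 1) →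
                   (∀ i → lookup ls i ≡ 2 → q i ≡ 0) →
                   ∑[ i < length ls ] q i + legs2 ls ≤ length ls
∑-+-legs2≤length ls q q≤1 q≡0 = begin
  ∑[ i < k ] q i + legs2 ls                            ≡⟨ cong (∑[ i < k ] q i +_) (legs2-∑ ls) ⟩
  ∑[ i < k ] q i + ∑[ i < k ] isTwo (lookup ls i)      ≡⟨ ∑-distrib-+ q (isTwo ∘ lookup ls) ⟨
  ∑[ i < k ] (q i + isTwo (lookup ls i))               ≤⟨ ∑-mono-≤ perLeg ⟩
  ∑[ i < k ] 1                                         ≡⟨ ∑-const-1 k ⟩
  k                                                    ∎
  where
  open ≤-Reasoning
  k = length ls
  perLeg : ∀ i → q i + isTwo (lookup ls i) ≤ 1
  perLeg i with isTwo-cases (lookup ls i)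
  ... | inj₁ (l≡2 , t≡1) = subst (_≤ 1) (cong₂ _+_ (sym (q≡0 i l≡2)) (sym t≡1)) ≤-refl
  ... | inj₂ (_   , t≡0) = subst (_≤ 1) (cong (q i +_) (sym t≡0))
                               (subst (_≤ 1) (sym (+-identityʳ (q i))) (q≤1 i))

LegwiseTRDF-balance : ∀ {ls c p} → All (1 ≤_) ls → LegwiseTRDF ls c p →
                      ∑[ i < length ls ] χ₂₀ (p i 0) c + sum ls ≤ ∑[ i < length ls ] χ₂₀ c (p i 0) + legsWeight ls p
LegwiseTRDF-balance {ls} {c} {p} one L = begin
  ∑[ i < k ] spent i + sum ls
    ≡⟨ cong (∑[ i < k ] spent i +_) (∑-lookup ls) ⟨
  ∑[ i < k ] spent i + ∑[ i < k ] lookup ls i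
    ≡⟨ ∑-distrib-+ spent (lookup ls) ⟨
  ∑[ i < k ] (spent i + lookup ls i)
    ≤⟨ ∑-mono-≤ (λ i → leg-bound (All-lookup one i) (LegwiseTRDF.legs L i)) ⟩
  ∑[ i < k ] (saved i + ∑< (lookup ls i) (p i))
    ≡⟨ ∑-distrib-+ saved (λ i → ∑< (lookup ls i) (p i)) ⟩
  ∑[ i < k ] saved i + legsWeight ls p
    ∎
  where
  open ≤-Reasoning
  k = length ls
  spent saved : Fin k → ℕ
  spent i = χ₂₀ (p i 0) c
  saved i = χ₂₀ c (p i 0)

-- The weight w of a TRDF of a spider of order n with k legs, y of them of length 2: either w ≥ n,
-- or the centre is labelled 2 and w ≥ n + 1 − d, where d counts the legs whose first vertex is 0.
LowerBound : (n k y w : ℕ) → Set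
LowerBound n k y w = n ≤ w ⊎ ∃ λ d → n + 1 ≤ w + d × d + y ≤ k × d < k

LegwiseTRDF-lowerBound : ∀ {ls c p} → All (1 ≤_) ls → LegwiseTRDF ls c p →
                         LowerBound (suc (sum ls)) (length ls) (legs2 ls) (c + legsWeight ls p)
LegwiseTRDF-lowerBound {ls} {0} {p} one L = inj₁ (begin
  1 + sum ls                                    ≤⟨ +-monoˡ-≤ (sum ls) spends ⟩
  ∑[ i < k ] χ₂₀ (p i 0) 0 + sum ls              ≤⟨ LegwiseTRDF-balance one L ⟩
  ∑[ i < k ] 0 + legsWeight ls p                ≡⟨ cong (_+ legsWeight ls p) (sum-replicate-zero k) ⟩
  legsWeight ls p                               ∎)
  where
  open ≤-Reasoning
  k = length ls
  spends : 1 ≤ ∑[ i < k ] χ₂₀ (p i 0) 0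
  spends with LegwiseTRDF.centre-dom L refl
  ... | i , pi0≡2 =
    ≤-trans (≤-reflexive (cong (λ x → χ₂₀ x 0) (sym pi0≡2))) (≤-∑ (λ i → χ₂₀ (p i 0) 0) i)
LegwiseTRDF-lowerBound {ls} {1} {p} one L = inj₁ (s≤s (begin
  sum ls                                        ≤⟨ m≤n+m (sum ls) _ ⟩
  ∑[ i < k ] χ₂₀ (p i 0) 1 + sum ls              ≤⟨ LegwiseTRDF-balance one L ⟩
  ∑[ i < k ] 0 + legsWeight ls p                ≡⟨ cong (_+ legsWeight ls p) (sum-replicate-zero k) ⟩
  legsWeight ls p                               ∎))
  where
  open ≤-Reasoning
  k = length ls
LegwiseTRDF-lowerBound {ls} {2} {p} one L = inj₂ (∑[ i < k ] saved i , short , saved+legs2≤k , saved<k)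
  where
  open LegwiseTRDF L
  k = length ls
  saved : Fin k → ℕ
  saved i = χ₂₀ 2 (p i 0)
  short : suc (sum ls) + 1 ≤ 2 + legsWeight ls p + ∑[ i < k ] saved i
  short = begin
    suc (sum ls) + 1           ≡⟨ +-comm (suc (sum ls)) 1 ⟩
    2 + sum ls                 ≤⟨ +-monoʳ-≤ 2 (≤-trans (m≤n+m (sum ls) _) (LegwiseTRDF-balance one L)) ⟩
    2 + (D + W)                ≡⟨ cong (2 +_) (+-comm D W) ⟩
    2 + (W + D)                ≡⟨ +-assoc 2 W D ⟨
    2 + W + D                  ∎
    where
    open ≤-Reasoning
    D = ∑[ i < k ] saved i
    W = legsWeight ls p
  saved+legs2≤k : ∑[ i < k ] saved i + legs2 ls ≤ k
  saved+legs2≤k = ∑-+-legs2≤length ls saved (λ i → χ₂₀-≤1 2 (p i 0))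
    (λ i l≡2 → χ₂₀-positive 2 (leg₂-head-positive (subst (LegTRDF 2 (p i)) l≡2 (legs i))))
  saved<k : ∑[ i < k ] saved i < k
  saved<k with centre-total z<s
  ... | i , 0<pi0 = ∑-indicator-< saved (λ i → χ₂₀-≤1 2 (p i 0)) i (χ₂₀-positive 2 0<pi0)
LegwiseTRDF-lowerBound {c = suc (suc (suc _))} _ L with LegwiseTRDF.centre-≤2 L
... | s≤s (s≤s ())

lowerBound-≤ : ∀ {n k y w} → k ≤ y + 1 → LowerBound n k y w → n ≤ w
lowerBound-≤ _ (inj₁ n≤w) = n≤w
lowerBound-≤ {n} {k} {y} {w} k≤y+1 (inj₂ (d , n+1≤w+d , d+y≤k , _)) =
  +-cancelʳ-≤ 1 n w (≤-trans n+1≤w+d (+-monoʳ-≤ w d≤1))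
  where
  d≤1 : d ≤ 1
  d≤1 = +-cancelʳ-≤ y d 1 (≤-trans d+y≤k (subst (k ≤_) (+-comm y 1) k≤y+1))

lowerBound-legs2 : ∀ {n k y w} → y < k → LowerBound n k y w → n + (y + 1) ≤ w + k
lowerBound-legs2 {k = k} {y} y<k (inj₁ n≤w) = +-mono-≤ n≤w (subst (_≤ k) (+-comm 1 y) y<k)
lowerBound-legs2 {n} {k} {y} {w} _ (inj₂ (d , n+1≤w+d , d+y≤k , _)) = begin
  n + (y + 1)    ≡⟨ cong (n +_) (+-comm y 1) ⟩
  n + (1 + y)    ≡⟨ +-assoc n 1 y ⟨
  n + 1 + y      ≤⟨ +-monoˡ-≤ y n+1≤w+d ⟩
  w + d + y      ≡⟨ +-assoc w d y ⟩
  w + (d + y)    ≤⟨ +-monoʳ-≤ w d+y≤k ⟩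
  w + k          ∎
  where open ≤-Reasoning

lowerBound-2 : ∀ {n k y w} → 2 ≤ k → LowerBound n k y w → n + 2 ≤ w + k
lowerBound-2 2≤k (inj₁ n≤w) = +-mono-≤ n≤w 2≤k
lowerBound-2 {n} {k} {w = w} _ (inj₂ (d , n+1≤w+d , _ , d<k)) = begin
  n + 2          ≡⟨ +-assoc n 1 1 ⟨
  n + 1 + 1      ≤⟨ +-monoˡ-≤ 1 n+1≤w+d ⟩
  w + d + 1      ≡⟨ +-assoc w d 1 ⟩
  w + (d + 1)    ≤⟨ +-monoʳ-≤ w (subst (_≤ k) (+-comm 1 d) d<k) ⟩
  w + k          ∎
  where open ≤-Reasoning

length≤sum : ∀ {ls} → All (1 ≤_) ls → length ls ≤ sum ls
length≤sum []           = z≤n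
length≤sum (1≤l ∷ one) = +-mono-≤ 1≤l (length≤sum one)

length≤order : ∀ {ls} → All (1 ≤_) ls → length ls ≤ suc (sum ls)
length≤order one = ≤-trans (length≤sum one) (n≤1+n _)

-- Optimal labellings

ones-LegwiseTRDF : ∀ {ls} → 1 ≤ length ls → LegwiseTRDF ls 1 (λ _ → headThenOnes 1)
ones-LegwiseTRDF {_ ∷ _} _ = record
  { centre-≤2    = s≤s z≤n
  ; legs         = λ _ → ones-LegTRDF _ z<s
  ; centre-dom   = λ ()
  ; centre-total = λ _ → zero , z<s
  }

headThenOnes-LegwiseTRDF : ∀ {ls} (x : Fin (length ls) → ℕ) →
                           (∀ i → x i ≡ 1 ⊎ x i ≡ 0 × lookup ls i ≢ 2) → (∃ λ i → x i ≡ 1) →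
                           LegwiseTRDF ls 2 (λ i → headThenOnes (x i))
headThenOnes-LegwiseTRDF {ls} x heads (i₁ , xi₁≡1) = record
  { centre-≤2    = ≤-refl
  ; legs         = λ i → legAt i (heads i)
  ; centre-dom   = λ ()
  ; centre-total = λ _ → i₁ , subst (0 <_) (sym xi₁≡1) z<s
  }
  where
  legAt : ∀ i → x i ≡ 1 ⊎ x i ≡ 0 × lookup ls i ≢ 2 → LegTRDF 2 (headThenOnes (x i)) (lookup ls i)
  legAt i (inj₁ xi≡1)         = subst (λ z → LegTRDF 2 (headThenOnes z) _) (sym xi≡1) (ones-LegTRDF _ z<s)
  legAt i (inj₂ (xi≡0 , l≢2)) = subst (λ z → LegTRDF 2 (headThenOnes z) _) (sym xi≡0) (zeroThenOnes-LegTRDF _ l≢2)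

legsWeight-headThenOnes : ∀ {ls} → All (1 ≤_) ls → (x : Fin (length ls) → ℕ) →
                          legsWeight ls (λ i → headThenOnes (x i)) + length ls ≡ sum ls + ∑[ i < length ls ] x i
legsWeight-headThenOnes {[]}         []         x = refl
legsWeight-headThenOnes {suc m ∷ ls} (_ ∷ one) x = begin
  ∑< (suc m) (headThenOnes x₀) + W + suc k
    ≡⟨ cong (λ s → s + W + suc k) (∑<-headThenOnes x₀ m) ⟩
  x₀ + m + W + suc k
    ≡⟨ solve 4 (λ a m W k → a :+ m :+ W :+ (con 1 :+ k) := con 1 :+ m :+ a :+ (W :+ k)) refl x₀ m W k ⟩
  suc m + x₀ + (W + k)
    ≡⟨ cong (suc m + x₀ +_) (legsWeight-headThenOnes one (x ∘ suc)) ⟩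
  suc m + x₀ + (sum ls + X)
    ≡⟨ solve 4 (λ m a s X → m :+ a :+ (s :+ X) := m :+ s :+ (a :+ X)) refl (suc m) x₀ (sum ls) X ⟩
  suc m + sum ls + (x₀ + X)
    ∎
  where
  open ≡-Reasoning
  x₀ = x zero
  k = length ls
  W = legsWeight ls (λ i → headThenOnes (x (suc i)))
  X = ∑[ i < k ] x (suc i)

legs2≥1⇒∃≡2 : ∀ ls → 1 ≤ legs2 ls → ∃ λ i → lookup ls i ≡ 2
legs2≥1⇒∃≡2 ls 1≤y with ∑-positive (isTwo ∘ lookup ls) (subst (0 <_) (legs2-∑ ls) 1≤y)
... | i , 0<t with isTwo-cases (lookup ls i)
...   | inj₁ (l≡2 , _)   = i , l≡2
...   | inj₂ (_   , t≡0) = ⊥-elim (<⇒≢ 0<t (sym t≡0))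

legs2≡0⇒≢2 : ∀ ls → legs2 ls ≡ 0 → ∀ i → lookup ls i ≢ 2
legs2≡0⇒≢2 ls y≡0 i l≡2 with isTwo-cases (lookup ls i)
... | inj₁ (_   , t≡1) =
  1+n≰n (subst (1 ≤_) (trans (sym (legs2-∑ ls)) y≡0)
          (subst (_≤ ∑[ j < length ls ] isTwo (lookup ls j)) t≡1 (≤-∑ (isTwo ∘ lookup ls) i)))
... | inj₂ (l≢2 , _)   = l≢2 l≡2

headThenOnes-weight : ∀ {ls} → All (1 ≤_) ls → (x : Fin (length ls) → ℕ) →
                      2 + legsWeight ls (λ i → headThenOnes (x i))
                        ≡ suc (sum ls) ∸ length ls + (∑[ i < length ls ] x i + 1)
headThenOnes-weight {ls} one x = ∸-+-≡ (length≤order one) (begin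
  2 + W + k          ≡⟨ +-assoc 2 W k ⟩
  2 + (W + k)        ≡⟨ cong (2 +_) (legsWeight-headThenOnes one x) ⟩
  2 + (sum ls + X)   ≡⟨ solve 2 (λ s X → con 2 :+ (s :+ X) := con 1 :+ s :+ (X :+ con 1)) refl (sum ls) X ⟩
  suc (sum ls) + (X + 1) ∎)
  where
  open ≡-Reasoning
  k = length ls
  W = legsWeight ls (λ i → headThenOnes (x i))
  X = ∑[ i < k ] x i

γtR≡-spider-mostLegs2 : ∀ {ls} → All (1 ≤_) ls → 1 ≤ length ls → length ls ≤ legs2 ls + 1 →
                        γtR≡ (spider ls) (suc (sum ls))
γtR≡-spider-mostLegs2 {ls} one 1≤k k≤y+1 =
  γtR≡-legwise one (1 , _ , ones-LegwiseTRDF 1≤k , cong suc W≡)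
    (λ L → lowerBound-≤ k≤y+1 (LegwiseTRDF-lowerBound one L))
  where
  W≡ : legsWeight ls (λ _ → headThenOnes 1) ≡ sum ls
  W≡ = +-cancelʳ-≡ (length ls) _ _
         (trans (legsWeight-headThenOnes one (λ _ → 1)) (cong (sum ls +_) (∑-const-1 (length ls))))

γtR≡-spider-someLegs2 : ∀ {ls} → All (1 ≤_) ls → 1 ≤ legs2 ls → legs2 ls + 1 < length ls →
                        γtR≡ (spider ls) (suc (sum ls) ∸ length ls + legs2 ls + 1)
γtR≡-spider-someLegs2 {ls} one 1≤y y+1<k =
  subst (γtR≡ (spider ls)) (sym (+-assoc _ (legs2 ls) 1))
    (γtR≡-legwise one (2 , _ , headThenOnes-LegwiseTRDF x xHeads xPositive , W≡)
      (λ L → ∸-+-≤ (length≤order one)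
               (lowerBound-legs2 (<-trans (m<m+n (legs2 ls) z<s) y+1<k) (LegwiseTRDF-lowerBound one L))))
  where
  x : Fin (length ls) → ℕ
  x i = isTwo (lookup ls i)
  xHeads : ∀ i → x i ≡ 1 ⊎ x i ≡ 0 × lookup ls i ≢ 2
  xHeads i with isTwo-cases (lookup ls i)
  ... | inj₁ (_ , t≡1)     = inj₁ t≡1
  ... | inj₂ (l≢2 , t≡0)   = inj₂ (t≡0 , l≢2)
  xPositive : ∃ λ i → x i ≡ 1
  xPositive with legs2≥1⇒∃≡2 ls 1≤y
  ... | i , l≡2 = i , cong isTwo l≡2
  W≡ : 2 + legsWeight ls (λ i → headThenOnes (x i)) ≡ suc (sum ls) ∸ length ls + (legs2 ls + 1)
  W≡ = trans (headThenOnes-weight one x)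
             (cong (λ y → suc (sum ls) ∸ length ls + (y + 1)) (sym (legs2-∑ ls)))

γtR≡-spider-noLegs2 : ∀ {ls} → All (1 ≤_) ls → 2 ≤ length ls → legs2 ls ≡ 0 →
                      γtR≡ (spider ls) (suc (sum ls) ∸ length ls + 2)
γtR≡-spider-noLegs2 {l ∷ ls} one 2≤k y≡0 =
  γtR≡-legwise one (2 , _ , headThenOnes-LegwiseTRDF first firstHeads (zero , refl) , W≡)
    (λ L → ∸-+-≤ (length≤order one) (lowerBound-2 2≤k (LegwiseTRDF-lowerBound one L)))
  where
  first : Fin (length (l ∷ ls)) → ℕ
  first zero    = 1
  first (suc _) = 0
  firstHeads : ∀ i → first i ≡ 1 ⊎ first i ≡ 0 × lookup (l ∷ ls) i ≢ 2
  firstHeads zero    = inj₁ refl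
  firstHeads (suc i) = inj₂ (refl , legs2≡0⇒≢2 (l ∷ ls) y≡0 (suc i))
  W≡ : 2 + legsWeight (l ∷ ls) (λ i → headThenOnes (first i)) ≡ suc (sum (l ∷ ls)) ∸ length (l ∷ ls) + 2
  W≡ = trans (headThenOnes-weight one first)
             (cong (λ s → suc (sum (l ∷ ls)) ∸ length (l ∷ ls) + (suc s + 1)) (sum-replicate-zero (length ls)))

mainTheorem14 : (ls : List ℕ) → All (1 ≤_) ls → 3 ≤ length ls →
    (legs2 ls + 1 ≥ length ls → γtR≡ (spider ls) (order (spider ls)))
    × (1 ≤ legs2 ls → legs2 ls + 1 < length ls →
        γtR≡ (spider ls) (order (spider ls) ∸ length ls + legs2 ls + 1))
    × (legs2 ls ≡ 0 → γtR≡ (spider ls) (order (spider ls) ∸ length ls + 2))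
mainTheorem14 ls one 3≤k =
  γtR≡-spider-mostLegs2 one (≤-trans (s≤s z≤n) 3≤k) ,
  γtR≡-spider-someLegs2 one ,
  γtR≡-spider-noLegs2 one (≤-trans (n≤1+n 2) 3≤k)
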